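{- Let $\phi$ be an LTL formula in negation normal form. If the propositional formula $of(\phi)$ is satisfiable, then there exists a consistent obligation $O\in olg(\phi)$.
   Context: Let $AP$ be a finite set of atomic propositions. A literal is $a$ or $\neg a$ for $a\in AP$. NNF LTL formulas are generated by $\phi ::= \mathit{tt}\mid \mathit{ff}\mid a\mid \neg a\mid \phi\wedge\phi\mid\phi\vee\phi\mid X\phi\mid \phi U\phi\mid \phi R\phi$. The obligation set $olg(\phi)$ is defined recursively: - $olg(\mathit{tt})=\{\emptyset\}$, $olg(\mathit{ff})=\{\{\mathit{ff}\}\}$; - $olg(p)=\{\{p\}\}$ for a literal $p$; - $olg(X\psi)=olg(\psi)$; - $olg(\psi_1\vee\psi_2)=olg(\psi_1)\cup olg(\psi_2)$; - $olg(\psi_1\wedge\psi_2)=\{O_1\cup O_2\mid O_i\in olg(\psi_i)\}$; - $olg(\psi_1U\psi_2)=olg(\psi_1R\psi_2)=olg(\psi_2)$. An obligation $O\in olg(\phi)$ is consistent if the propositional formula $\bigwedge_{a\in O}a$ is not equivalent to $\mathit{ff}$. The obligation formula $of(\phi)$ is defined recursively: - $of(\mathit{tt})=\mathit{tt}$, $of(\mathit{ff})=\mathit{ff}$; - $of(p)=p$ for a literal $p$; - $of(X\psi)=of(\psi)$; - $of(\phi_1U\phi_2)=of(\phi_1R\phi_2)=of(\phi_2)$; - $of(\phi_1\wedge\phi_2)=of(\phi_1)\wedge of(\phi_2)$; - $of(\phi_1\vee\phi_2)=of(\phi_1)\vee of(\phi_2)$. $of(\phi)$ is a propositional formula over $AP$,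 with $\neg a$ read as negation. -}

module Defs where

open import Data.Nat using (ℕ)
open import Data.Fin using (Fin)
open import Data.Bool using (Bool; true; false; not; _∧_; _∨_)
open import Data.List using (List; []; _∷_; _++_; concatMap; map)
open import Data.Product using (∃; _×_)
open import Data.List.Membership.Propositional using (_∈_)
open import Relation.Binary.PropositionalEquality using (_≡_)

data LTL (n : ℕ) : Set where
  tt ff : LTL n
  pos neg : Fin n → LTL n
  _∧ₗ_ _∨ₗ_ : LTL n → LTL n → LTL n
  X : LTL n → LTL n
  _U_ _R_ : LTL n → LTL n → LTL n

data OElem (n : ℕ) : Set where
  ffₒ : OElem n
  posₒ negₒ : Fin n → OElem n

-- An obligation is a finite set of elements, represented as a list.
Obligation : ℕ → Set
Obligation n = List (OElem n)

-- olg(φ) as a list of obligations (a finite set up to duplicates/order).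
olg : ∀ {n} → LTL n → List (Obligation n)
olg tt = [] ∷ []
olg ff = (ffₒ ∷ []) ∷ []
olg (pos a) = (posₒ a ∷ []) ∷ []
olg (neg a) = (negₒ a ∷ []) ∷ []
olg (X ψ) = olg ψ
olg (ψ₁ ∨ₗ ψ₂) = olg ψ₁ ++ olg ψ₂
olg (ψ₁ ∧ₗ ψ₂) = concatMap (λ O₁ → map (λ O₂ → O₁ ++ O₂) (olg ψ₂)) (olg ψ₁)
olg (ψ₁ U ψ₂) = olg ψ₂
olg (ψ₁ R ψ₂) = olg ψ₂

data PForm (n : ℕ) : Set where
  ttₚ ffₚ : PForm n
  posₚ negₚ : Fin n → PForm n
  _∧ₚ_ _∨ₚ_ : PForm n → PForm n → PForm n

Valuation : ℕ → Set
Valuation n = Fin n → Bool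

evalP : ∀ {n} → Valuation n → PForm n → Bool
evalP v ttₚ = true
evalP v ffₚ = false
evalP v (posₚ a) = v a
evalP v (negₚ a) = not (v a)
evalP v (φ ∧ₚ ψ) = evalP v φ ∧ evalP v ψ
evalP v (φ ∨ₚ ψ) = evalP v φ ∨ evalP v ψ

Satisfiable : ∀ {n} → PForm n → Set
Satisfiable {n} φ = ∃ λ (v : Valuation n) → evalP v φ ≡ true

of : ∀ {n} → LTL n → PForm n
of tt = ttₚ
of ff = ffₚ
of (pos a) = posₚ a
of (neg a) = negₚ a
of (X ψ) = of ψ
of (φ₁ U φ₂) = of φ₂
of (φ₁ R φ₂) = of φ₂
of (φ₁ ∧ₗ φ₂) = of φ₁ ∧ₚ of φ₂
of (φ₁ ∨ₗ φ₂) = of φ₁ ∨ₚ of φ₂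

elemP : ∀ {n} → OElem n → PForm n
elemP ffₒ = ffₚ
elemP (posₒ a) = posₚ a
elemP (negₒ a) = negₚ a

conjO : ∀ {n} → Obligation n → PForm n
conjO [] = ttₚ
conjO (e ∷ O) = elemP e ∧ₚ conjO O

-- O is consistent iff ⋀O is not equivalent to ff, i.e. it is satisfiable.
Consistent : ∀ {n} → Obligation n → Set
Consistent O = Satisfiable (conjO O)

-- A valuation v satisfying of(φ) selects, by induction on φ, an obligation all of whose
-- elements v makes true: at a disjunction follow a disjunct v satisfies, at a conjunction
-- take the union of the obligations selected for both conjuncts. That obligation is
-- then consistent, with v as witness.
module Submission where

open import Defs
open import Data.Nat using (ℕ)
open import Data.Bool using (Bool; true; false; _∧_; _∨_)
open import Data.Bool.Properties using (∧-assoc; ∧-conicalˡ; ∧-conicalʳ)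
open import Data.Product using (∃; _×_; _,_)
open import Data.Sum using (_⊎_; inj₁; inj₂)
open import Data.List using ([]; _∷_; _++_; map)
open import Data.List.Membership.Propositional using (_∈_)
open import Data.List.Membership.Propositional.Properties using (∈-++⁺ˡ; ∈-++⁺ʳ; ∈-map⁺; ∈-concatMap⁺)
open import Data.List.Relation.Unary.Any as Any using (here)
open import Relation.Binary.PropositionalEquality using (_≡_; refl; sym; cong₂; module ≡-Reasoning)

∨-true : ∀ {x y : Bool} → x ∨ y ≡ true → x ≡ true ⊎ y ≡ true
∨-true {true}  _ = inj₁ refl
∨-true {false} h = inj₂ h

evalP-conjO-++ : ∀ {n} (v : Valuation n) (O₁ O₂ : Obligation n) →
  evalP v (conjO (O₁ ++ O₂)) ≡ evalP v (conjO O₁) ∧ evalP v (conjO O₂)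
evalP-conjO-++ v []       O₂ = refl
evalP-conjO-++ v (e ∷ O₁) O₂
  rewrite evalP-conjO-++ v O₁ O₂ = sym (∧-assoc (evalP v (elemP e)) _ _)

∈-olg-∧ : ∀ {n} {O₁ O₂ : Obligation n} (φ ψ : LTL n) →
  O₁ ∈ olg φ → O₂ ∈ olg ψ → O₁ ++ O₂ ∈ olg (φ ∧ₗ ψ)
∈-olg-∧ φ ψ m₁ m₂ =
  ∈-concatMap⁺ (λ O → map (O ++_) (olg ψ))
    (Any.map (λ { refl → ∈-map⁺ (_ ++_) m₂ }) m₁)

SatisfiedObligation : ∀ {n} → Valuation n → LTL n → Set
SatisfiedObligation {n} v φ =
  ∃ λ (O : Obligation n) → O ∈ olg φ × evalP v (conjO O) ≡ true

satisfiedObligation : ∀ {n} (v : Valuation n) (φ : LTL n) →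
  evalP v (of φ) ≡ true → SatisfiedObligation v φ
satisfiedObligation v tt      h = [] , here refl , refl
satisfiedObligation v ff      ()
satisfiedObligation v (pos a) h = _ , here refl , cong₂ _∧_ h refl
satisfiedObligation v (neg a) h = _ , here refl , cong₂ _∧_ h refl
satisfiedObligation v (X φ)   h = satisfiedObligation v φ h
satisfiedObligation v (φ U ψ) h = satisfiedObligation v ψ h
satisfiedObligation v (φ R ψ) h = satisfiedObligation v ψ h
satisfiedObligation v (φ ∨ₗ ψ) h with ∨-true {evalP v (of φ)} h
... | inj₁ hφ = let O , m , s = satisfiedObligation v φ hφ in O , ∈-++⁺ˡ m , s
... | inj₂ hψ = let O , m , s = satisfiedObligation v ψ hψ in O , ∈-++⁺ʳ (olg φ) m , s
satisfiedObligation v (φ ∧ₗ ψ) h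
  with satisfiedObligation v φ (∧-conicalˡ _ _ h)
     | satisfiedObligation v ψ (∧-conicalʳ (evalP v (of φ)) _ h)
... | O₁ , m₁ , s₁ | O₂ , m₂ , s₂ =
  O₁ ++ O₂ , ∈-olg-∧ φ ψ m₁ m₂ ,
  (begin
    evalP v (conjO (O₁ ++ O₂))                 ≡⟨ evalP-conjO-++ v O₁ O₂ ⟩
    evalP v (conjO O₁) ∧ evalP v (conjO O₂)    ≡⟨ cong₂ _∧_ s₁ s₂ ⟩
    true                                       ∎)
  where open ≡-Reasoning

lemma3 : ∀ {n : ℕ} (φ : LTL n) → Satisfiable (of φ) →
    ∃ λ (O : Obligation n) → O ∈ olg φ × Consistent O
lemma3 φ (v , h) = let O , m , s = satisfiedObligation v φ h in O , m , (v , s)
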